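{- For all $s,t\in\mathbb{Q}$, the numbers $x=-t\,(s^{18}+3s^{17}t-15s^{16}t^2+15s^{15}t^3+6s^{14}t^4-45s^{13}t^5+82s^{12}t^6-15s^{11}t^7-123s^{10}t^8+171s^9t^9-159s^8t^{10}+159s^7t^{11}-98s^6t^{12}+30s^5t^{13}-12s^4t^{14}+3s^2t^{16}+t^{18})$, $y=-s^{19}+s^{18}t+3s^{17}t^2+3s^{16}t^3-21s^{15}t^4+12s^{14}t^5+44s^{13}t^6-86s^{12}t^7+93s^{11}t^8-87s^{10}t^9-3s^9t^{10}+135s^8t^{11}-142s^7t^{12}+100s^6t^{13}-72s^5t^{14}+36s^4t^{15}-12s^3t^{16}+9s^2t^{17}-st^{18}+t^{19}$, $z=t\,(s^{18}-3s^{17}t+3s^{16}t^2+21s^{15}t^3-60s^{14}t^4+27s^{13}t^5+58s^{12}t^6-75s^{11}t^7+57s^{10}t^8-63s^9t^9+63s^8t^{10}-87s^7t^{11}+100s^6t^{12}-66s^5t^{13}+36s^4t^{14}-18s^3t^{15}+9s^2t^{16}+t^{18})$, $w=-s^{19}+s^{18}t+3s^{17}t^2+3s^{16}t^3-21s^{15}t^4+6s^{14}t^5+44s^{13}t^6-62s^{12}t^7-15s^{11}t^8+129s^{10}t^9-165s^9t^{10}+129s^8t^{11}-88s^7t^{12}+46s^6t^{13}-18s^5t^{14}+6s^4t^{15}-12s^3t^{16}+3s^2t^{17}-st^{18}+t^{19}$ satisfy $x^4+y^4=z^4+w^4$. -}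

module Defs where

open import Data.Nat using (ℕ; zero; suc)
open import Data.Integer using (+_)
open import Data.Rational using (ℚ; _/_; _+_; _*_; _-_; -_; 1ℚ)

k : ℕ → ℚ
k n = + n / 1

infixr 8 _^_
_^_ : ℚ → ℕ → ℚ
q ^ zero = 1ℚ
q ^ suc n = q * q ^ n

xP : ℚ → ℚ → ℚ
xP s t = - (t * (s ^ 18 + k 3 * s ^ 17 * t - k 15 * s ^ 16 * t ^ 2 + k 15 * s ^ 15 * t ^ 3
  + k 6 * s ^ 14 * t ^ 4 - k 45 * s ^ 13 * t ^ 5 + k 82 * s ^ 12 * t ^ 6 - k 15 * s ^ 11 * t ^ 7
  - k 123 * s ^ 10 * t ^ 8 + k 171 * s ^ 9 * t ^ 9 - k 159 * s ^ 8 * t ^ 10 + k 159 * s ^ 7 * t ^ 11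
  - k 98 * s ^ 6 * t ^ 12 + k 30 * s ^ 5 * t ^ 13 - k 12 * s ^ 4 * t ^ 14 + k 3 * s ^ 2 * t ^ 16 + t ^ 18))

yP : ℚ → ℚ → ℚ
yP s t = - (s ^ 19) + s ^ 18 * t + k 3 * s ^ 17 * t ^ 2 + k 3 * s ^ 16 * t ^ 3 - k 21 * s ^ 15 * t ^ 4
  + k 12 * s ^ 14 * t ^ 5 + k 44 * s ^ 13 * t ^ 6 - k 86 * s ^ 12 * t ^ 7 + k 93 * s ^ 11 * t ^ 8
  - k 87 * s ^ 10 * t ^ 9 - k 3 * s ^ 9 * t ^ 10 + k 135 * s ^ 8 * t ^ 11 - k 142 * s ^ 7 * t ^ 12
  + k 100 * s ^ 6 * t ^ 13 - k 72 * s ^ 5 * t ^ 14 + k 36 * s ^ 4 * t ^ 15 - k 12 * s ^ 3 * t ^ 16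
  + k 9 * s ^ 2 * t ^ 17 - s * t ^ 18 + t ^ 19

zP : ℚ → ℚ → ℚ
zP s t = t * (s ^ 18 - k 3 * s ^ 17 * t + k 3 * s ^ 16 * t ^ 2 + k 21 * s ^ 15 * t ^ 3
  - k 60 * s ^ 14 * t ^ 4 + k 27 * s ^ 13 * t ^ 5 + k 58 * s ^ 12 * t ^ 6 - k 75 * s ^ 11 * t ^ 7
  + k 57 * s ^ 10 * t ^ 8 - k 63 * s ^ 9 * t ^ 9 + k 63 * s ^ 8 * t ^ 10 - k 87 * s ^ 7 * t ^ 11
  + k 100 * s ^ 6 * t ^ 12 - k 66 * s ^ 5 * t ^ 13 + k 36 * s ^ 4 * t ^ 14 - k 18 * s ^ 3 * t ^ 15
  + k 9 * s ^ 2 * t ^ 16 + t ^ 18)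

wP : ℚ → ℚ → ℚ
wP s t = - (s ^ 19) + s ^ 18 * t + k 3 * s ^ 17 * t ^ 2 + k 3 * s ^ 16 * t ^ 3 - k 21 * s ^ 15 * t ^ 4
  + k 6 * s ^ 14 * t ^ 5 + k 44 * s ^ 13 * t ^ 6 - k 62 * s ^ 12 * t ^ 7 - k 15 * s ^ 11 * t ^ 8
  + k 129 * s ^ 10 * t ^ 9 - k 165 * s ^ 9 * t ^ 10 + k 129 * s ^ 8 * t ^ 11 - k 88 * s ^ 7 * t ^ 12
  + k 46 * s ^ 6 * t ^ 13 - k 18 * s ^ 5 * t ^ 14 + k 6 * s ^ 4 * t ^ 15 - k 12 * s ^ 3 * t ^ 16
  + k 3 * s ^ 2 * t ^ 17 - s * t ^ 18 + t ^ 19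

-- Both sides are integer polynomials of degree 76 in s and t, and the claim is
-- an identity of polynomials. It is verified by reflection: the formulas are
-- transcribed as syntax, normalised to dense coefficient lists in ℚ[s][t], and
-- the normal form of the difference of the two sides is checked by evaluation
-- to have only zero coefficients. Soundness rests on Horner evaluation being a
-- ring homomorphism, proved once for coefficients interpreted in an arbitrary
-- commutative ring and iterated to pass from ℚ to ℚ[s] to ℚ[s][t].
module Submission where

open import Algebra.Bundles using (CommutativeRing)
import Algebra.Properties.CommutativeSemigroup as CommutativeSemigroupProperties
import Algebra.Properties.Ring as RingProperties
open import Data.Bool using (Bool; true; false; if_then_else_)
open import Data.Bool.Properties using (∧-conicalˡ; ∧-conicalʳ)
open import Data.Bool.ListAction using (all)
open import Data.List using (List; []; _∷_; map)
open import Data.Nat using (ℕ; zero; suc)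
open import Data.Rational using (ℚ; 0ℚ; 1ℚ)
import Data.Rational as ℚ
import Data.Rational.Properties as ℚ
open import Level using (_⊔_)
open import Relation.Binary.PropositionalEquality using (_≡_; module ≡-Reasoning)
import Relation.Binary.PropositionalEquality as ≡
open import Relation.Nullary using (yes)
open import Relation.Nullary.Decidable using (⌊_⌋)
import Defs

record CoefficientOps (A : Set) : Set where
  infixl 6 _+_
  infixl 7 _*_
  infix 8 -_
  field
    0# 1# : A
    _+_ _*_ : A → A → A
    -_ : A → A
    isZero : A → Bool

  power : A → ℕ → A
  power a zero = 1#
  power a (suc n) = a * power a n

-- Polynomials are coefficient lists, constant term first; trailing zeros are
-- allowed, so a polynomial has many representations.
module Polynomial {A : Set} (C : CoefficientOps A) where
  open CoefficientOps C

  infixl 6 _+ₚ_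
  infixl 7 _*ₚ_ _·_

  _+ₚ_ : List A → List A → List A
  [] +ₚ q = q
  (a ∷ p) +ₚ [] = a ∷ p
  (a ∷ p) +ₚ (b ∷ q) = a + b ∷ p +ₚ q

  -- Skipping zero scalars keeps products of sparse polynomials cheap.
  _·_ : A → List A → List A
  a · q = if isZero a then [] else map (a *_) q

  _*ₚ_ : List A → List A → List A
  [] *ₚ q = []
  (a ∷ p) *ₚ q = a · q +ₚ (0# ∷ p *ₚ q)

  constant : A → List A
  constant a = a ∷ []

  X : List A
  X = 0# ∷ 1# ∷ []

  polynomialOps : CoefficientOps (List A)
  polynomialOps = record
    { 0# = []
    ; 1# = constant 1#
    ; _+_ = _+ₚ_
    ; _*_ = _*ₚ_
    ; -_ = map -_
    ; isZero = all isZero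
    }

record Interpretation {c ℓ} (R : CommutativeRing c ℓ) {A : Set} (C : CoefficientOps A) : Set (c ⊔ ℓ) where
  private
    module R = CommutativeRing R
    module C = CoefficientOps C
  field
    ⟦_⟧ : A → R.Carrier
    ⟦0⟧ : ⟦ C.0# ⟧ R.≈ R.0#
    ⟦1⟧ : ⟦ C.1# ⟧ R.≈ R.1#
    ⟦+⟧ : ∀ a b → ⟦ a C.+ b ⟧ R.≈ ⟦ a ⟧ R.+ ⟦ b ⟧
    ⟦*⟧ : ∀ a b → ⟦ a C.* b ⟧ R.≈ ⟦ a ⟧ R.* ⟦ b ⟧
    ⟦-⟧ : ∀ a → ⟦ C.- a ⟧ R.≈ R.- ⟦ a ⟧
    isZero-sound : ∀ a → C.isZero a ≡ true → ⟦ a ⟧ R.≈ R.0#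

module Horner {c ℓ} {R : CommutativeRing c ℓ} {A : Set} {C : CoefficientOps A}
  (I : Interpretation R C) where

  open CommutativeRing R
  open RingProperties ring using (-0#≈0#; -‿distribʳ-*; -‿+-comm)
  open CommutativeSemigroupProperties +-commutativeSemigroup using (interchange)
  open CommutativeSemigroupProperties *-commutativeSemigroup using (x∙yz≈y∙xz)
  open Interpretation I
  open Polynomial C
  open import Relation.Binary.Reasoning.Setoid setoid
  private
    module C = CoefficientOps C

  eval : List A → Carrier → Carrier
  eval [] x = 0#
  eval (a ∷ p) x = ⟦ a ⟧ + x * eval p x

  eval-constant : ∀ a x → eval (constant a) x ≈ ⟦ a ⟧
  eval-constant a x = trans (+-congˡ (zeroʳ x)) (+-identityʳ ⟦ a ⟧)

  eval-X : ∀ x → eval X x ≈ x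
  eval-X x = begin
    ⟦ C.0# ⟧ + x * eval (constant C.1#) x ≈⟨ +-cong ⟦0⟧ (*-congˡ (trans (eval-constant C.1# x) ⟦1⟧)) ⟩
    0# + x * 1#                         ≈⟨ +-identityˡ (x * 1#) ⟩
    x * 1#                              ≈⟨ *-identityʳ x ⟩
    x                                   ∎

  eval-+ : ∀ p q x → eval (p +ₚ q) x ≈ eval p x + eval q x
  eval-+ [] q x = sym (+-identityˡ (eval q x))
  eval-+ (a ∷ p) [] x = sym (+-identityʳ (eval (a ∷ p) x))
  eval-+ (a ∷ p) (b ∷ q) x = begin
    ⟦ a C.+ b ⟧ + x * eval (p +ₚ q) x               ≈⟨ +-cong (⟦+⟧ a b) (*-congˡ (eval-+ p q x)) ⟩
    (⟦ a ⟧ + ⟦ b ⟧) + x * (eval p x + eval q x)       ≈⟨ +-congˡ (distribˡ x (eval p x) (eval q x)) ⟩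
    (⟦ a ⟧ + ⟦ b ⟧) + (x * eval p x + x * eval q x)   ≈⟨ interchange ⟦ a ⟧ ⟦ b ⟧ (x * eval p x) (x * eval q x) ⟩
    (⟦ a ⟧ + x * eval p x) + (⟦ b ⟧ + x * eval q x)   ∎

  eval-neg : ∀ p x → eval (map C.-_ p) x ≈ - eval p x
  eval-neg [] x = sym -0#≈0#
  eval-neg (a ∷ p) x = begin
    ⟦ C.- a ⟧ + x * eval (map C.-_ p) x  ≈⟨ +-cong (⟦-⟧ a) (*-congˡ (eval-neg p x)) ⟩
    - ⟦ a ⟧ + x * - eval p x            ≈⟨ +-congˡ (sym (-‿distribʳ-* x (eval p x))) ⟩
    - ⟦ a ⟧ + - (x * eval p x)          ≈⟨ -‿+-comm ⟦ a ⟧ (x * eval p x) ⟩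
    - (⟦ a ⟧ + x * eval p x)            ∎

  eval-map-* : ∀ a q x → eval (map (a C.*_) q) x ≈ ⟦ a ⟧ * eval q x
  eval-map-* a [] x = sym (zeroʳ ⟦ a ⟧)
  eval-map-* a (b ∷ q) x = begin
    ⟦ a C.* b ⟧ + x * eval (map (a C.*_) q) x  ≈⟨ +-cong (⟦*⟧ a b) (*-congˡ (eval-map-* a q x)) ⟩
    ⟦ a ⟧ * ⟦ b ⟧ + x * (⟦ a ⟧ * eval q x)     ≈⟨ +-congˡ (x∙yz≈y∙xz x ⟦ a ⟧ (eval q x)) ⟩
    ⟦ a ⟧ * ⟦ b ⟧ + ⟦ a ⟧ * (x * eval q x)     ≈⟨ distribˡ ⟦ a ⟧ ⟦ b ⟧ (x * eval q x) ⟨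
    ⟦ a ⟧ * (⟦ b ⟧ + x * eval q x)            ∎

  eval-· : ∀ a q x → eval (a · q) x ≈ ⟦ a ⟧ * eval q x
  eval-· a q x with C.isZero a in a≟0
  ... | true = sym (trans (*-congʳ (isZero-sound a a≟0)) (zeroˡ (eval q x)))
  ... | false = eval-map-* a q x

  eval-* : ∀ p q x → eval (p *ₚ q) x ≈ eval p x * eval q x
  eval-* [] q x = sym (zeroˡ (eval q x))
  eval-* (a ∷ p) q x = begin
    eval (a · q +ₚ (C.0# ∷ p *ₚ q)) x                    ≈⟨ eval-+ (a · q) (C.0# ∷ p *ₚ q) x ⟩
    eval (a · q) x + (⟦ C.0# ⟧ + x * eval (p *ₚ q) x)    ≈⟨ +-cong (eval-· a q x) (+-cong ⟦0⟧ (*-congˡ (eval-* p q x))) ⟩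
    ⟦ a ⟧ * eval q x + (0# + x * (eval p x * eval q x))  ≈⟨ +-congˡ (trans (+-identityˡ _) (sym (*-assoc x (eval p x) (eval q x)))) ⟩
    ⟦ a ⟧ * eval q x + x * eval p x * eval q x           ≈⟨ distribʳ (eval q x) ⟦ a ⟧ (x * eval p x) ⟨
    (⟦ a ⟧ + x * eval p x) * eval q x                    ∎

  eval-all-isZero : ∀ p x → all C.isZero p ≡ true → eval p x ≈ 0#
  eval-all-isZero [] x _ = refl
  eval-all-isZero (a ∷ p) x p≟0 = begin
    ⟦ a ⟧ + x * eval p x
      ≈⟨ +-cong (isZero-sound a (∧-conicalˡ _ _ p≟0)) (*-congˡ (eval-all-isZero p x (∧-conicalʳ _ _ p≟0))) ⟩
    0# + x * 0#           ≈⟨ +-identityˡ (x * 0#) ⟩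
    x * 0#                ≈⟨ zeroʳ x ⟩
    0#                    ∎

  evalAt : Carrier → Interpretation R polynomialOps
  evalAt x = record
    { ⟦_⟧ = λ p → eval p x
    ; ⟦0⟧ = refl
    ; ⟦1⟧ = trans (eval-constant C.1# x) ⟦1⟧
    ; ⟦+⟧ = λ p q → eval-+ p q x
    ; ⟦*⟧ = λ p q → eval-* p q x
    ; ⟦-⟧ = λ p → eval-neg p x
    ; isZero-sound = λ p → eval-all-isZero p x
    }

ℚ-coefficients : CoefficientOps ℚ
ℚ-coefficients = record
  { 0# = 0ℚ
  ; 1# = 1ℚ
  ; _+_ = ℚ._+_
  ; _*_ = ℚ._*_
  ; -_ = ℚ.-_
  ; isZero = λ q → ⌊ q ℚ.≟ 0ℚ ⌋
  }

ℚ-identity : Interpretation ℚ.+-*-commutativeRing ℚ-coefficients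
ℚ-identity = record
  { ⟦_⟧ = λ q → q
  ; ⟦0⟧ = ≡.refl
  ; ⟦1⟧ = ≡.refl
  ; ⟦+⟧ = λ _ _ → ≡.refl
  ; ⟦*⟧ = λ _ _ → ≡.refl
  ; ⟦-⟧ = λ _ → ≡.refl
  ; isZero-sound = isZero-sound
  }
  where
  isZero-sound : ∀ q → ⌊ q ℚ.≟ 0ℚ ⌋ ≡ true → q ≡ 0ℚ
  isZero-sound q _ with q ℚ.≟ 0ℚ
  ... | yes q≡0 = q≡0

module ℚ[s] = Polynomial ℚ-coefficients
module ℚ[s][t] = Polynomial ℚ[s].polynomialOps

evalAt₂ : ℚ → ℚ → Interpretation ℚ.+-*-commutativeRing ℚ[s][t].polynomialOps
evalAt₂ σ τ = Horner.evalAt (Horner.evalAt ℚ-identity σ) τ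

-- Terms use the operator names and fixities of Data.Rational and Defs, so
-- the formulas of Defs can be transcribed verbatim below.
module Expression where

  infixl 6 _+_ _-_
  infixl 7 _*_
  infix 8 -_
  infixr 8 _^_

  data Expr : Set where
    s t : Expr
    k : ℕ → Expr
    _+_ _-_ _*_ : Expr → Expr → Expr
    -_ : Expr → Expr
    _^_ : Expr → ℕ → Expr

  ⟦_⟧ : Expr → ℚ → ℚ → ℚ
  ⟦ s ⟧ σ τ = σ
  ⟦ t ⟧ σ τ = τ
  ⟦ k n ⟧ σ τ = Defs.k n
  ⟦ e + f ⟧ σ τ = ⟦ e ⟧ σ τ ℚ.+ ⟦ f ⟧ σ τ
  ⟦ e - f ⟧ σ τ = ⟦ e ⟧ σ τ ℚ.- ⟦ f ⟧ σ τ
  ⟦ e * f ⟧ σ τ = ⟦ e ⟧ σ τ ℚ.* ⟦ f ⟧ σ τ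
  ⟦ - e ⟧ σ τ = ℚ.- ⟦ e ⟧ σ τ
  ⟦ e ^ n ⟧ σ τ = ⟦ e ⟧ σ τ Defs.^ n

  open CoefficientOps ℚ[s][t].polynomialOps
    renaming (_+_ to _+ₙ_; _*_ to _*ₙ_; -_ to -ₙ_)

  normalise : Expr → List (List ℚ)
  normalise s = ℚ[s][t].constant ℚ[s].X
  normalise t = ℚ[s][t].X
  normalise (k n) = ℚ[s][t].constant (ℚ[s].constant (Defs.k n))
  normalise (e + f) = normalise e +ₙ normalise f
  normalise (e - f) = normalise e +ₙ -ₙ normalise f
  normalise (e * f) = normalise e *ₙ normalise f
  normalise (- e) = -ₙ normalise e
  normalise (e ^ n) = power (normalise e) n

  module _ (σ τ : ℚ) where
    open Interpretation (evalAt₂ σ τ)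
      renaming (⟦_⟧ to ⟦_⟧ₙ)
    open ≡-Reasoning

    normalise-sound : ∀ e → ⟦ normalise e ⟧ₙ ≡ ⟦ e ⟧ σ τ
    normalise-sound s = begin
      ⟦ ℚ[s][t].constant ℚ[s].X ⟧ₙ     ≡⟨ Horner.eval-constant (Horner.evalAt ℚ-identity σ) ℚ[s].X τ ⟩
      Horner.eval ℚ-identity ℚ[s].X σ  ≡⟨ Horner.eval-X ℚ-identity σ ⟩
      σ                                ∎
    normalise-sound t = Horner.eval-X (Horner.evalAt ℚ-identity σ) τ
    normalise-sound (k n) = begin
      ⟦ ℚ[s][t].constant (ℚ[s].constant (Defs.k n)) ⟧ₙ
        ≡⟨ Horner.eval-constant (Horner.evalAt ℚ-identity σ) (ℚ[s].constant (Defs.k n)) τ ⟩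
      Horner.eval ℚ-identity (ℚ[s].constant (Defs.k n)) σ
        ≡⟨ Horner.eval-constant ℚ-identity (Defs.k n) σ ⟩
      Defs.k n ∎
    normalise-sound (e + f) =
      ≡.trans (⟦+⟧ (normalise e) (normalise f)) (≡.cong₂ ℚ._+_ (normalise-sound e) (normalise-sound f))
    normalise-sound (e - f) =
      ≡.trans (⟦+⟧ (normalise e) (-ₙ normalise f))
        (≡.cong₂ ℚ._+_ (normalise-sound e) (≡.trans (⟦-⟧ (normalise f)) (≡.cong ℚ.-_ (normalise-sound f))))
    normalise-sound (e * f) =
      ≡.trans (⟦*⟧ (normalise e) (normalise f)) (≡.cong₂ ℚ._*_ (normalise-sound e) (normalise-sound f))
    normalise-sound (- e) = ≡.trans (⟦-⟧ (normalise e)) (≡.cong ℚ.-_ (normalise-sound e))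
    normalise-sound (e ^ zero) = ⟦1⟧
    normalise-sound (e ^ suc n) =
      ≡.trans (⟦*⟧ (normalise e) (power (normalise e) n)) (≡.cong₂ ℚ._*_ (normalise-sound e) (normalise-sound (e ^ n)))

  open RingProperties (CommutativeRing.ring ℚ.+-*-commutativeRing) using (+-inverseˡ-unique; -‿involutive)

  equal-if-difference-normalises-to-zero : ∀ e f → isZero (normalise (e - f)) ≡ true →
    ∀ σ τ → ⟦ e ⟧ σ τ ≡ ⟦ f ⟧ σ τ
  equal-if-difference-normalises-to-zero e f e-f≟0 σ τ =
    ≡.trans (+-inverseˡ-unique (⟦ e ⟧ σ τ) (ℚ.- ⟦ f ⟧ σ τ) e-f≡0) (-‿involutive (⟦ f ⟧ σ τ))
    where
    e-f≡0 : ⟦ e ⟧ σ τ ℚ.- ⟦ f ⟧ σ τ ≡ 0ℚ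
    e-f≡0 = ≡.trans (≡.sym (normalise-sound σ τ (e - f)))
                    (Interpretation.isZero-sound (evalAt₂ σ τ) (normalise (e - f)) e-f≟0)

  x y z w : Expr
  x = - (t * (s ^ 18 + k 3 * s ^ 17 * t - k 15 * s ^ 16 * t ^ 2 + k 15 * s ^ 15 * t ^ 3
    + k 6 * s ^ 14 * t ^ 4 - k 45 * s ^ 13 * t ^ 5 + k 82 * s ^ 12 * t ^ 6 - k 15 * s ^ 11 * t ^ 7
    - k 123 * s ^ 10 * t ^ 8 + k 171 * s ^ 9 * t ^ 9 - k 159 * s ^ 8 * t ^ 10 + k 159 * s ^ 7 * t ^ 11
    - k 98 * s ^ 6 * t ^ 12 + k 30 * s ^ 5 * t ^ 13 - k 12 * s ^ 4 * t ^ 14 + k 3 * s ^ 2 * t ^ 16 + t ^ 18))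
  y = - (s ^ 19) + s ^ 18 * t + k 3 * s ^ 17 * t ^ 2 + k 3 * s ^ 16 * t ^ 3 - k 21 * s ^ 15 * t ^ 4
    + k 12 * s ^ 14 * t ^ 5 + k 44 * s ^ 13 * t ^ 6 - k 86 * s ^ 12 * t ^ 7 + k 93 * s ^ 11 * t ^ 8
    - k 87 * s ^ 10 * t ^ 9 - k 3 * s ^ 9 * t ^ 10 + k 135 * s ^ 8 * t ^ 11 - k 142 * s ^ 7 * t ^ 12
    + k 100 * s ^ 6 * t ^ 13 - k 72 * s ^ 5 * t ^ 14 + k 36 * s ^ 4 * t ^ 15 - k 12 * s ^ 3 * t ^ 16
    + k 9 * s ^ 2 * t ^ 17 - s * t ^ 18 + t ^ 19
  z = t * (s ^ 18 - k 3 * s ^ 17 * t + k 3 * s ^ 16 * t ^ 2 + k 21 * s ^ 15 * t ^ 3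
    - k 60 * s ^ 14 * t ^ 4 + k 27 * s ^ 13 * t ^ 5 + k 58 * s ^ 12 * t ^ 6 - k 75 * s ^ 11 * t ^ 7
    + k 57 * s ^ 10 * t ^ 8 - k 63 * s ^ 9 * t ^ 9 + k 63 * s ^ 8 * t ^ 10 - k 87 * s ^ 7 * t ^ 11
    + k 100 * s ^ 6 * t ^ 12 - k 66 * s ^ 5 * t ^ 13 + k 36 * s ^ 4 * t ^ 14 - k 18 * s ^ 3 * t ^ 15
    + k 9 * s ^ 2 * t ^ 16 + t ^ 18)
  w = - (s ^ 19) + s ^ 18 * t + k 3 * s ^ 17 * t ^ 2 + k 3 * s ^ 16 * t ^ 3 - k 21 * s ^ 15 * t ^ 4
    + k 6 * s ^ 14 * t ^ 5 + k 44 * s ^ 13 * t ^ 6 - k 62 * s ^ 12 * t ^ 7 - k 15 * s ^ 11 * t ^ 8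
    + k 129 * s ^ 10 * t ^ 9 - k 165 * s ^ 9 * t ^ 10 + k 129 * s ^ 8 * t ^ 11 - k 88 * s ^ 7 * t ^ 12
    + k 46 * s ^ 6 * t ^ 13 - k 18 * s ^ 5 * t ^ 14 + k 6 * s ^ 4 * t ^ 15 - k 12 * s ^ 3 * t ^ 16
    + k 3 * s ^ 2 * t ^ 17 - s * t ^ 18 + t ^ 19

  lhs rhs : Expr
  lhs = x ^ 4 + y ^ 4
  rhs = z ^ 4 + w ^ 4

open Defs
open Data.Rational using (_+_)

mainTheorem6 : (s t : ℚ) → xP s t ^ 4 + yP s t ^ 4 ≡ zP s t ^ 4 + wP s t ^ 4
mainTheorem6 = Expression.equal-if-difference-normalises-to-zero Expression.lhs Expression.rhs ≡.refl
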